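{- Let $q_1,\dots,q_n,q,p\in F(V)$. Then: (1) if $q_1,\dots,q_n\vdash_{Ł^*}q$, then $q_1,\dots,q_n\vdash_{\mathrm{sq}Ł^*}(p\to p)\to q$; (2) if $q$ is regular, then $(p\to p)\to q\vdash_{\mathrm{sq}Ł^*}q$.
   Context: $F(V)$ is the set of formulas built from a set $V$ of propositional variables with $\to$, $\neg$ and the constant $1$. Abbreviations: $p^+=(p\to1)\to1$, $p^-=(p\to\neg1)\to\neg1$, $p\vee q=((p^+\to q^+)^+\to(\neg p)^-)\to((q^-\to p^-)^-\to p^-)$; an axiom written $p\leftrightarrow q$ stands for the two axioms $p\to q$ and $q\to p$. A formula is regular if it contains an occurrence of $\to$ or of $1$. For a logic $L$, $\Gamma\vdash_L q$ means there is a finite sequence ending in $q$ each member of which is an axiom of $L$, a member of $\Gamma$, or obtained from earlier members by a rule of $L$. The logic $Ł^*$ (Chang): axioms (P1) $(p\to q)\leftrightarrow(\neg q\to\neg p)$; (P2) $p\leftrightarrow((q\to q)\to p)$; (P3) $\neg(p\to q)\leftrightarrow(q\to p)$; (P4) $p\to1$; (P5) $1\leftrightarrow((1\to p)\to1)$; (P6) $((p\to1)\to((q\to1)\to r))\to((q\to1)\to((p\to1)\to r))$; (P7) $(p\to q)\leftrightarrow((q^+\to p^-)\to(p^+\to q^-))$; (P8) $(p\to(\neg p\to q))^+\leftrightarrow(p^+\to(\neg p^+\to q^+))$; (P9) $(p\to(q\vee r))\leftrightarrow((p\to r)\vee(p\to q))$; (P10) $(p\vee(q\vee r))\leftrightarrow((p\vee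 q)\vee r)$; rules (R1) $p,\ p\to q\vdash q$; (R2) $p\to q,\ r\to t\vdash(q\to r)\to(p\to t)$; (R3) $p\vdash p^-$. The logic $\mathrm{sq}Ł^*$: axioms (Q1) $(p\to q)\leftrightarrow(\neg q\to\neg p)$; (Q2) $1\leftrightarrow((1\to p)\to1)$; (Q3) $p\leftrightarrow((q\to q)\to p)$; (Q4) $(p\to q)\leftrightarrow((q^+\to p^-)\to(p^+\to q^-))$; (Q5) $\neg(p\to q)\leftrightarrow(q\to p)$; (Q6) $(p\to(\neg p\to q))^+\leftrightarrow(p^+\to(\neg p^+\to q^+))$; (Q7) $(p\to(q\vee r))\leftrightarrow((p\to r)\vee(p\to q))$; (Q8) $(p\vee(q\vee r))\leftrightarrow((p\vee q)\vee r)$; (Q9) $((p\to1)\to((q\to1)\to r))\to((q\to1)\to((p\to1)\to r))$; (Q10) $p\to1$; rules (qMP) $(r\to r)\to p,\ (r\to r)\to(p\to q)\vdash(r\to r)\to q$; (Reg) $p\vdash(r\to r)\to p$; (AReg1) $(r\to r)\to(p\to q)\vdash p\to q$; (AReg2) $(r\to r)\to\neg(p\to q)\vdash\neg(p\to q)$; (AReg3) $(r\to r)\to\neg1\vdash\neg1$; (AReg4) $(r\to r)\to1\vdash1$; (Inv1) $p\vdash\neg\neg p$; (Inv2) $\neg\neg p\vdash p$; (Flat) $p,\neg1\vdash\neg p$; (R2$'$) $p\to q,\ r\to t\vdash(q\to r)\to(p\to t)$; (R3$'$) $(r\to r)\to p\vdash p^-$. -}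

module Defs where

open import Data.List using (List)
open import Data.List.Membership.Propositional using (_∈_)

infixr 5 _⇒_
infix 7 ~_

data Fm (V : Set) : Set where
  var : V → Fm V
  _⇒_ : Fm V → Fm V → Fm V
  ~_  : Fm V → Fm V
  one : Fm V

module _ {V : Set} where

  _⁺ : Fm V → Fm V
  p ⁺ = (p ⇒ one) ⇒ one

  _⁻ : Fm V → Fm V
  p ⁻ = (p ⇒ ~ one) ⇒ ~ one

  _∨_ : Fm V → Fm V → Fm V
  p ∨ q = (((p ⁺ ⇒ q ⁺) ⁺) ⇒ ((~ p) ⁻)) ⇒ ((((q ⁻) ⇒ (p ⁻)) ⁻) ⇒ (p ⁻))

  -- regular: contains an occurrence of → or of 1
  data Regular : Fm V → Set where
    reg-one : Regular one
    reg-imp : ∀ {a b} → Regular (a ⇒ b)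
    reg-neg : ∀ {a} → Regular a → Regular (~ a)

  -- Axioms of Chang's logic Ł* (each p ↔ q split into two axioms)
  data AxŁ : Fm V → Set where
    P1a : ∀ p q → AxŁ ((p ⇒ q) ⇒ (~ q ⇒ ~ p))
    P1b : ∀ p q → AxŁ ((~ q ⇒ ~ p) ⇒ (p ⇒ q))
    P2a : ∀ p q → AxŁ (p ⇒ ((q ⇒ q) ⇒ p))
    P2b : ∀ p q → AxŁ (((q ⇒ q) ⇒ p) ⇒ p)
    P3a : ∀ p q → AxŁ (~ (p ⇒ q) ⇒ (q ⇒ p))
    P3b : ∀ p q → AxŁ ((q ⇒ p) ⇒ ~ (p ⇒ q))
    P4  : ∀ p → AxŁ (p ⇒ one)
    P5a : ∀ p → AxŁ (one ⇒ ((one ⇒ p) ⇒ one))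
    P5b : ∀ p → AxŁ (((one ⇒ p) ⇒ one) ⇒ one)
    P6  : ∀ p q r → AxŁ (((p ⇒ one) ⇒ ((q ⇒ one) ⇒ r)) ⇒ ((q ⇒ one) ⇒ ((p ⇒ one) ⇒ r)))
    P7a : ∀ p q → AxŁ ((p ⇒ q) ⇒ ((q ⁺ ⇒ p ⁻) ⇒ (p ⁺ ⇒ q ⁻)))
    P7b : ∀ p q → AxŁ (((q ⁺ ⇒ p ⁻) ⇒ (p ⁺ ⇒ q ⁻)) ⇒ (p ⇒ q))
    P8a : ∀ p q → AxŁ (((p ⇒ (~ p ⇒ q)) ⁺) ⇒ (p ⁺ ⇒ ((~ (p ⁺)) ⇒ q ⁺)))
    P8b : ∀ p q → AxŁ ((p ⁺ ⇒ ((~ (p ⁺)) ⇒ q ⁺)) ⇒ ((p ⇒ (~ p ⇒ q)) ⁺))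
    P9a : ∀ p q r → AxŁ ((p ⇒ (q ∨ r)) ⇒ ((p ⇒ r) ∨ (p ⇒ q)))
    P9b : ∀ p q r → AxŁ (((p ⇒ r) ∨ (p ⇒ q)) ⇒ (p ⇒ (q ∨ r)))
    P10a : ∀ p q r → AxŁ ((p ∨ (q ∨ r)) ⇒ ((p ∨ q) ∨ r))
    P10b : ∀ p q r → AxŁ (((p ∨ q) ∨ r) ⇒ (p ∨ (q ∨ r)))

  -- Γ ⊢_{Ł*} q  (inductive form of "finite sequence of axioms, hypotheses, rule applications")
  data _⊢Ł_ (Γ : List (Fm V)) : Fm V → Set where
    ax  : ∀ {q} → AxŁ q → Γ ⊢Ł q
    hyp : ∀ {q} → q ∈ Γ → Γ ⊢Ł q
    R1  : ∀ {p q} → Γ ⊢Ł p → Γ ⊢Ł (p ⇒ q) → Γ ⊢Ł q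
    R2  : ∀ {p q r t} → Γ ⊢Ł (p ⇒ q) → Γ ⊢Ł (r ⇒ t) → Γ ⊢Ł ((q ⇒ r) ⇒ (p ⇒ t))
    R3  : ∀ {p} → Γ ⊢Ł p → Γ ⊢Ł (p ⁻)

  data AxSq : Fm V → Set where
    Q1a : ∀ p q → AxSq ((p ⇒ q) ⇒ (~ q ⇒ ~ p))
    Q1b : ∀ p q → AxSq ((~ q ⇒ ~ p) ⇒ (p ⇒ q))
    Q2a : ∀ p → AxSq (one ⇒ ((one ⇒ p) ⇒ one))
    Q2b : ∀ p → AxSq (((one ⇒ p) ⇒ one) ⇒ one)
    Q3a : ∀ p q → AxSq (p ⇒ ((q ⇒ q) ⇒ p))
    Q3b : ∀ p q → AxSq (((q ⇒ q) ⇒ p) ⇒ p)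
    Q4a : ∀ p q → AxSq ((p ⇒ q) ⇒ ((q ⁺ ⇒ p ⁻) ⇒ (p ⁺ ⇒ q ⁻)))
    Q4b : ∀ p q → AxSq (((q ⁺ ⇒ p ⁻) ⇒ (p ⁺ ⇒ q ⁻)) ⇒ (p ⇒ q))
    Q5a : ∀ p q → AxSq (~ (p ⇒ q) ⇒ (q ⇒ p))
    Q5b : ∀ p q → AxSq ((q ⇒ p) ⇒ ~ (p ⇒ q))
    Q6a : ∀ p q → AxSq (((p ⇒ (~ p ⇒ q)) ⁺) ⇒ (p ⁺ ⇒ ((~ (p ⁺)) ⇒ q ⁺)))
    Q6b : ∀ p q → AxSq ((p ⁺ ⇒ ((~ (p ⁺)) ⇒ q ⁺)) ⇒ ((p ⇒ (~ p ⇒ q)) ⁺))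
    Q7a : ∀ p q r → AxSq ((p ⇒ (q ∨ r)) ⇒ ((p ⇒ r) ∨ (p ⇒ q)))
    Q7b : ∀ p q r → AxSq (((p ⇒ r) ∨ (p ⇒ q)) ⇒ (p ⇒ (q ∨ r)))
    Q8a : ∀ p q r → AxSq ((p ∨ (q ∨ r)) ⇒ ((p ∨ q) ∨ r))
    Q8b : ∀ p q r → AxSq (((p ∨ q) ∨ r) ⇒ (p ∨ (q ∨ r)))
    Q9  : ∀ p q r → AxSq (((p ⇒ one) ⇒ ((q ⇒ one) ⇒ r)) ⇒ ((q ⇒ one) ⇒ ((p ⇒ one) ⇒ r)))
    Q10 : ∀ p → AxSq (p ⇒ one)

  data _⊢Sq_ (Γ : List (Fm V)) : Fm V → Set where
    ax    : ∀ {q} → AxSq q → Γ ⊢Sq q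
    hyp   : ∀ {q} → q ∈ Γ → Γ ⊢Sq q
    qMP   : ∀ {p q r} → Γ ⊢Sq ((r ⇒ r) ⇒ p) → Γ ⊢Sq ((r ⇒ r) ⇒ (p ⇒ q)) → Γ ⊢Sq ((r ⇒ r) ⇒ q)
    Reg   : ∀ {p} r → Γ ⊢Sq p → Γ ⊢Sq ((r ⇒ r) ⇒ p)
    AReg1 : ∀ {p q r} → Γ ⊢Sq ((r ⇒ r) ⇒ (p ⇒ q)) → Γ ⊢Sq (p ⇒ q)
    AReg2 : ∀ {p q r} → Γ ⊢Sq ((r ⇒ r) ⇒ ~ (p ⇒ q)) → Γ ⊢Sq (~ (p ⇒ q))
    AReg3 : ∀ {r} → Γ ⊢Sq ((r ⇒ r) ⇒ ~ one) → Γ ⊢Sq (~ one)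
    AReg4 : ∀ {r} → Γ ⊢Sq ((r ⇒ r) ⇒ one) → Γ ⊢Sq one
    Inv1  : ∀ {p} → Γ ⊢Sq p → Γ ⊢Sq (~ ~ p)
    Inv2  : ∀ {p} → Γ ⊢Sq (~ ~ p) → Γ ⊢Sq p
    Flat  : ∀ {p} → Γ ⊢Sq p → Γ ⊢Sq (~ one) → Γ ⊢Sq (~ p)
    R2′   : ∀ {p q r t} → Γ ⊢Sq (p ⇒ q) → Γ ⊢Sq (r ⇒ t) → Γ ⊢Sq ((q ⇒ r) ⇒ (p ⇒ t))
    R3′   : ∀ {p r} → Γ ⊢Sq ((r ⇒ r) ⇒ p) → Γ ⊢Sq (p ⁻)

-- Every axiom of Ł* is an axiom of sqŁ*, and every rule of Ł* is simulated
-- under the guard (p ⇒ p) ⇒ _ : R1 becomes qMP, R3 becomes R3′, and R2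
-- becomes R2′ once AReg1 has unguarded its implicational premises.  The guard
-- can be dropped from a regular formula: AReg1–AReg4 handle the formulas
-- a ⇒ b, 1, ~(a ⇒ b), ~1, and a double negation ~~x is reduced to x under the
-- guard using ~~x ⇒ x, which holds in sqŁ* for every regular x.
module Submission where

open import Defs
open import Data.List using (List; _∷_; [])
open import Data.Product using (_×_; _,_)
open import Data.List.Relation.Unary.Any using (here)
open import Relation.Binary.PropositionalEquality using (refl)

AxŁ⇒AxSq : ∀ {V} {q : Fm V} → AxŁ q → AxSq q
AxŁ⇒AxSq (P1a p q)      = Q1a p q
AxŁ⇒AxSq (P1b p q)      = Q1b p q
AxŁ⇒AxSq (P2a p q)      = Q3a p q
AxŁ⇒AxSq (P2b p q)      = Q3b p q
AxŁ⇒AxSq (P3a p q)      = Q5a p q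
AxŁ⇒AxSq (P3b p q)      = Q5b p q
AxŁ⇒AxSq (P4 p)         = Q10 p
AxŁ⇒AxSq (P5a p)        = Q2a p
AxŁ⇒AxSq (P5b p)        = Q2b p
AxŁ⇒AxSq (P6 p q r)     = Q9 p q r
AxŁ⇒AxSq (P7a p q)      = Q4a p q
AxŁ⇒AxSq (P7b p q)      = Q4b p q
AxŁ⇒AxSq (P8a p q)      = Q6a p q
AxŁ⇒AxSq (P8b p q)      = Q6b p q
AxŁ⇒AxSq (P9a p q r)    = Q7a p q r
AxŁ⇒AxSq (P9b p q r)    = Q7b p q r
AxŁ⇒AxSq (P10a p q r)   = Q8a p q r
AxŁ⇒AxSq (P10b p q r)   = Q8b p q r

module _ {V : Set} {Γ : List (Fm V)} where

  ⊢Ł⇒⊢Sq-guarded : ∀ {q : Fm V} (p : Fm V) → Γ ⊢Ł q → Γ ⊢Sq ((p ⇒ p) ⇒ q)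
  ⊢Ł⇒⊢Sq-guarded p (ax a)   = Reg p (ax (AxŁ⇒AxSq a))
  ⊢Ł⇒⊢Sq-guarded p (hyp m)  = Reg p (hyp m)
  ⊢Ł⇒⊢Sq-guarded p (R1 d e) = qMP (⊢Ł⇒⊢Sq-guarded p d) (⊢Ł⇒⊢Sq-guarded p e)
  ⊢Ł⇒⊢Sq-guarded p (R2 d e) =
    Reg p (R2′ (AReg1 (⊢Ł⇒⊢Sq-guarded p d)) (AReg1 (⊢Ł⇒⊢Sq-guarded p e)))
  ⊢Ł⇒⊢Sq-guarded p (R3 d)   = Reg p (R3′ (⊢Ł⇒⊢Sq-guarded p d))

  -- Modus ponens is only available in sqŁ* for implicational conclusions,
  -- since only those can be unguarded unconditionally (AReg1).
  mp⇒ : ∀ {X Y Z : Fm V} → Γ ⊢Sq X → Γ ⊢Sq (X ⇒ (Y ⇒ Z)) → Γ ⊢Sq (Y ⇒ Z)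
  mp⇒ x x⇒y⇒z = AReg1 {r = one} (qMP (Reg one x) (Reg one x⇒y⇒z))

  -- Q9 with p = q = 1 is the identity on (1 ⇒ 1) ⇒ ((1 ⇒ 1) ⇒ C); Q3 then
  -- removes the two guards.
  ⇒-refl : ∀ (C : Fm V) → Γ ⊢Sq (C ⇒ C)
  ⇒-refl C =
    mp⇒ (mp⇒ (ax (Q9 one one C)) (unguard-both ((one ⇒ one) ⇒ C))) (unguard-both C)
    where
    unguard-both : ∀ D → Γ ⊢Sq ((((one ⇒ one) ⇒ D) ⇒ ((one ⇒ one) ⇒ D)) ⇒ (D ⇒ D))
    unguard-both D = R2′ (ax (Q3a D one)) (ax (Q3b D one))

  ⇒-trans : ∀ {A B C : Fm V} → Γ ⊢Sq (A ⇒ B) → Γ ⊢Sq (B ⇒ C) → Γ ⊢Sq (A ⇒ C)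
  ⇒-trans {C = C} a⇒b b⇒c = mp⇒ b⇒c (R2′ a⇒b (⇒-refl C))

  contrapose : ∀ {A B : Fm V} → Γ ⊢Sq (A ⇒ B) → Γ ⊢Sq (~ B ⇒ ~ A)
  contrapose {A} {B} a⇒b = mp⇒ a⇒b (ax (Q1a A B))

  ~~-elim  : ∀ {x : Fm V} → Regular x → Γ ⊢Sq (~ ~ x ⇒ x)
  ~~-intro : ∀ {x : Fm V} → Regular x → Γ ⊢Sq (x ⇒ ~ ~ x)
  ~~-elim reg-one               = ax (Q10 _)
  ~~-elim (reg-imp {a} {b})     = ⇒-trans (contrapose (ax (Q5b a b))) (ax (Q5a b a))
  ~~-elim (reg-neg x-reg)       = contrapose (~~-intro x-reg)
  -- 1 is routed through the implication (1 ⇒ 1) ⇒ 1 (Q2 and Q10).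
  ~~-intro reg-one              =
    ⇒-trans (ax (Q2a one))
      (⇒-trans (~~-intro reg-imp) (contrapose (contrapose (ax (Q10 _)))))
  ~~-intro (reg-imp {a} {b})    = ⇒-trans (ax (Q5b b a)) (contrapose (ax (Q5a a b)))
  ~~-intro (reg-neg x-reg)      = contrapose (~~-elim x-reg)

  unguard : ∀ {x r : Fm V} → Regular x → Γ ⊢Sq ((r ⇒ r) ⇒ x) → Γ ⊢Sq x
  unguard reg-one                     g = AReg4 g
  unguard reg-imp                     g = AReg1 g
  unguard (reg-neg reg-one)           g = AReg3 g
  unguard (reg-neg reg-imp)           g = AReg2 g
  unguard {r = r} (reg-neg (reg-neg x-reg)) g =
    Inv1 (unguard x-reg (qMP g (Reg r (~~-elim x-reg))))

lemma4p1 : {V : Set} (qs : List (Fm V)) (q p : Fm V) →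
    (qs ⊢Ł q → qs ⊢Sq ((p ⇒ p) ⇒ q)) × (Regular q → (((p ⇒ p) ⇒ q) ∷ []) ⊢Sq q)
lemma4p1 qs q p = ⊢Ł⇒⊢Sq-guarded p , λ q-reg → unguard q-reg (hyp (here refl))
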